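{- Let $n,m\ge 2$. The grid $P_m \,\square\, P_n$ (Cartesian product of paths on $m$ and $n$ vertices) is a ${\cal D}$ graph for the Maker-Breaker total domination game if both $m$ and $n$ are even, and it is an ${\cal S}$ graph otherwise.
   Context: All graphs are finite and simple. The Maker-Breaker total domination (MBTD) game on a graph $G$ is played by Dominator and Staller, who alternately select a vertex of $G$ not selected before. Dominator wins if at some point the set of vertices he has selected is a total dominating set of $G$ (every vertex of $G$ has a neighbour in it); otherwise Staller wins, equivalently if she selects all vertices of the open neighbourhood of some vertex. The D-game is the game where Dominator moves first, the S-game where Staller moves first. A graph is ${\cal D}$ if Dominator has a winning strategy in both the D-game and the S-game, ${\cal S}$ if Staller has a winning strategy in both, and ${\cal N}$ if the first player has a winning strategy (Dominator wins the D-game and Staller wins the S-game), assuming optimal play. -}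

module Defs where

open import Data.Nat using (ℕ; suc)
open import Data.Fin using (Fin; toℕ)
open import Data.Product using (_×_; ∃; _,_)
open import Data.Sum using (_⊎_)
open import Data.List using (List; []; _∷_)
open import Data.List.Membership.Propositional using (_∈_; _∉_)
open import Relation.Binary.PropositionalEquality using (_≡_)

-- A position is the pair (D , S) of lists of vertices selected so far by
-- Dominator and Staller respectively.
module MBTD {V : Set} (Adj : V → V → Set) where

  TotDom : List V → Set
  TotDom D = ∀ x → ∃ λ y → y ∈ D × Adj x y

  StallerClaimsNbhd : List V → Set
  StallerClaimsNbhd S = ∃ λ x → ∀ y → Adj x y → y ∈ S

  Free : List V → List V → V → Set
  Free D S v = (v ∉ D) × (v ∉ S)

  -- Dominator has a winning strategy from position (D , S),
  -- with Dominator to move (DomWinsD) or Staller to move (DomWinsS).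
  data DomWinsD : List V → List V → Set
  data DomWinsS : List V → List V → Set

  data DomWinsD where
    won  : ∀ {D S} → TotDom D → DomWinsD D S
    move : ∀ {D S} v → Free D S v → DomWinsS (v ∷ D) S → DomWinsD D S

  data DomWinsS where
    won   : ∀ {D S} → TotDom D → DomWinsS D S
    reply : ∀ {D S} → (∃ λ v → Free D S v)
          → (∀ v → Free D S v → DomWinsD D (v ∷ S)) → DomWinsS D S

  data StaWinsD : List V → List V → Set
  data StaWinsS : List V → List V → Set

  data StaWinsS where
    won  : ∀ {D S} → StallerClaimsNbhd S → StaWinsS D S
    move : ∀ {D S} v → Free D S v → StaWinsD D (v ∷ S) → StaWinsS D S

  data StaWinsD where
    won   : ∀ {D S} → StallerClaimsNbhd S → StaWinsD D S
    reply : ∀ {D S} → (∃ λ v → Free D S v)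
          → (∀ v → Free D S v → StaWinsS (v ∷ D) S) → StaWinsD D S

  -- Outcome classes (D-game: Dominator moves first; S-game: Staller first)
  IsD : Set
  IsD = DomWinsD [] [] × DomWinsS [] []

  IsS : Set
  IsS = StaWinsD [] [] × StaWinsS [] []

  IsN : Set
  IsN = DomWinsD [] [] × StaWinsS [] []

PathAdj : ∀ {k} → Fin k → Fin k → Set
PathAdj a b = (suc (toℕ a) ≡ toℕ b) ⊎ (suc (toℕ b) ≡ toℕ a)

GridAdj : (m n : ℕ) → Fin m × Fin n → Fin m × Fin n → Set
GridAdj m n (i , j) (k , l) = ((i ≡ k) × PathAdj j l) ⊎ (PathAdj i k × (j ≡ l))

IsDGraph : (m n : ℕ) → Set
IsDGraph m n = MBTD.IsD (GridAdj m n)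

IsSGraph : (m n : ℕ) → Set
IsSGraph m n = MBTD.IsS (GridAdj m n)

-- Even grids: pair the vertices 2a and 2a + 1 of each path and pair grid vertices
-- coordinatewise.  Writing ′ for the partner, (i , j) is adjacent to (i , j′) and to its partner (i′ , j),
-- so by answering each Staller move with its partner Dominator ends up totally dominating.
--
-- Odd grids P_(2r+3) □ P_n: Staller claims (1,0), (3,0), …, (2r+1,0) in turn.  Each claim
-- (2k+1,0) takes the last free neighbour but one of (2k,0), forcing Dominator onto (2k,1);
-- the final claim threatens both (2r,0) and (2r+2,0), and Dominator cannot block both.
-- In the D-game Staller plays this on a reflected or transposed copy of the grid avoiding
-- Dominator's first vertex; only the middle row of P_3 needs the transposed copy.
module Submission where

open import Defs
open import Data.Empty using (⊥-elim)
open import Data.Fin using (Fin; zero; suc; toℕ; opposite; combine; remQuot)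
open import Data.Fin.Properties
  using (toℕ<n; toℕ≤pred[n]; opposite-prop; opposite-involutive; toℕ-combine; remQuot-combine;
         combine-surjective; combine-injectiveʳ)
  renaming (_≟_ to _≟ᶠ_)
open import Data.List using (List; []; _∷_; [_]; length; filter; map; cartesianProduct; allFin)
open import Data.List.Membership.Propositional using (_∈_; _∉_; lose)
open import Data.List.Membership.Propositional.Properties
  using (∈-filter⁺; ∈-map⁺; ∈-map⁻; ∈-cartesianProduct⁺; ∈-allFin)
open import Data.List.Properties using (filter-notAll)
open import Data.List.Relation.Unary.Any as Any using (here; there; any?; satisfied)
open import Data.Nat using (ℕ; zero; suc; pred; _+_; _*_; _≤_; _<_; s≤s)
open import Data.Nat.Base using (parity)
open import Data.Nat.Divisibility using (_∣_; _∣?_; divides; divides-refl)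
open import Data.Nat.Properties
  using (≤-refl; ≤-trans; ≤-pred; n≤1+n; m≤n⇒m≤1+n; m≤n⇒m<n∨m≡n; m≤n+m; <⇒≢; 0≢1+n;
         suc-injective; +-suc; +-identityʳ; +-cancelʳ-≡; m∸n+n≡m; *-suc; *-monoʳ-≤; *-cancelˡ-≡)
  renaming (_≟_ to _≟ⁿ_)
open import Data.Parity.Base using (Parity; 0ℙ; 1ℙ)
open import Data.Product using (_×_; ∃; _,_; proj₁; proj₂; uncurry; swap)
open import Data.Product.Properties using (≡-dec)
open import Data.Sum as Sum using (_⊎_; inj₁; inj₂; [_,_]′)
open import Function using (_∘_)
open import Relation.Binary.Definitions using (DecidableEquality)
open import Relation.Binary.PropositionalEquality
  using (_≡_; _≢_; refl; sym; trans; cong; cong₂; subst; module ≡-Reasoning)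
open import Relation.Nullary using (¬_; yes; no; ¬?)
open import Relation.Nullary.Decidable using (_×-dec_)
open import Relation.Unary using (Decidable)

∉-∷ : ∀ {A : Set} {v u : A} {L : List A} → v ≢ u → v ∉ L → v ∉ u ∷ L
∉-∷ v≢u v∉L (here v≡u) = v≢u v≡u
∉-∷ v≢u v∉L (there v∈L) = v∉L v∈L

module StallerThreats {V : Set} (Adj : V → V → Set) (_≟_ : DecidableEquality V) where
  open MBTD Adj

  claim-last : ∀ {D S} x g → (∀ y → Adj x y → y ∈ S ⊎ y ≡ g) → Free D S g → StaWinsS D S
  claim-last x g nbhd free-g = move g free-g (won (x , λ y x~y → [ there , here ]′ (nbhd y x~y)))

  threat : ∀ {D S} x s f → Free D S s → Free D (s ∷ S) f → (∀ y → Adj x y → y ∈ s ∷ S ⊎ y ≡ f)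
         → StaWinsS (f ∷ D) (s ∷ S) → StaWinsS D S
  threat {D} {S} x s f free-s free-f nbhd forced = move s free-s (reply (f , free-f) respond)
    where
    respond : ∀ w → Free D (s ∷ S) w → StaWinsS (w ∷ D) (s ∷ S)
    respond w _ with w ≟ f
    ... | yes refl = forced
    ... | no w≢f = claim-last x f nbhd (∉-∷ (w≢f ∘ sym) (proj₁ free-f) , proj₂ free-f)

module _ {V : Set} (Adj : V → V → Set) where
  open MBTD Adj

  isS-from-answers : V → (∀ v → StaWinsS [ v ] []) → StaWinsS [] [] → IsS
  isS-from-answers v₀ answer first = reply (v₀ , (λ ()) , (λ ())) (λ v _ → answer v) , first

module PairingStrategy {V : Set} (Adj : V → V → Set) (_≟_ : DecidableEquality V)
  (vertices : List V) (∈-vertices : ∀ v → v ∈ vertices)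
  (partner : V → V) (partner-involutive : ∀ v → partner (partner v) ≡ v)
  (partner-≢ : ∀ v → partner v ≢ v)
  (partners-dominate : ∀ x → ∃ λ y → Adj x y × Adj x (partner y)) where
  open MBTD Adj
  open import Data.List.Membership.DecPropositional _≟_ using (_∈?_; _∉?_)

  Paired : List V → List V → Set
  Paired D S = ∀ v → v ∈ S → partner v ∈ D

  free? : ∀ D S → Decidable (Free D S)
  free? D S v = (v ∉? D) ×-dec (v ∉? S)

  paired-totDom : ∀ {D S} → Paired D S → (∀ v → ¬ Free D S v) → TotDom D
  paired-totDom {D} {S} paired full x with partners-dominate x
  ... | y , x~y , x~y′ with y ∈? D | y ∈? S
  ...   | yes y∈D | _       = y , y∈D , x~y
  ...   | no _    | yes y∈S = partner y , paired y y∈S , x~y′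
  ...   | no y∉D  | no y∉S  = ⊥-elim (full y (y∉D , y∉S))

  Covers : List V → List V → List V → Set
  Covers D S F = ∀ v → Free D S v → v ∈ F

  without : V → List V → List V
  without v = filter (λ u → ¬? (u ≟ v))

  without-shorter : ∀ {v F} → v ∈ F → length (without v F) < length F
  without-shorter v∈F = filter-notAll _ _ (Any.map (λ v≡u u≢v → u≢v (sym v≡u)) v∈F)

  without-≤ : ∀ {v F k} → v ∈ F → length F ≤ suc k → length (without v F) ≤ k
  without-≤ v∈F F≤1+k = ≤-pred (≤-trans (without-shorter v∈F) F≤1+k)

  covers-∷ᴰ : ∀ {D S F w} → Covers D S F → Covers (w ∷ D) S F
  covers-∷ᴰ covers v (v∉w∷D , v∉S) = covers v (v∉w∷D ∘ there , v∉S)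

  covers-∷ˢ : ∀ {D S F w} → Covers D S F → Covers D (w ∷ S) (without w F)
  covers-∷ˢ covers v (v∉D , v∉w∷S) =
    ∈-filter⁺ _ (covers v (v∉D , v∉w∷S ∘ there)) (v∉w∷S ∘ here)

  no-free-vertex : ∀ {D S} → ¬ Any.Any (Free D S) vertices → ∀ v → ¬ Free D S v
  no-free-vertex none v free = none (lose (∈-vertices v) free)

  -- The fuel k bounds the free vertices through the cover F and drops with each Staller move.
  mutual
    stallerToMove : ∀ {D S} k F → length F ≤ k → Covers D S F → Paired D S → DomWinsS D S
    stallerToMove {D} {S} k F F≤k covers paired with any? (free? D S) vertices
    ... | no none  = won (paired-totDom paired (no-free-vertex none))
    ... | yes some = reply (satisfied some) (dominatorReplies k F F≤k covers paired)

    dominatorReplies : ∀ {D S} k F → length F ≤ k → Covers D S F → Paired D S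
           → ∀ v → Free D S v → DomWinsD D (v ∷ S)
    dominatorReplies zero F F≤0 covers _ v free with ≤-trans (without-shorter (covers v free)) F≤0
    ... | ()
    dominatorReplies {D} {S} (suc k) F F≤1+k covers paired v free@(v∉D , v∉S) with partner v ∈? D
    ... | yes pv∈D =
      dominatorToMove k (without v F) (without-≤ (covers v free) F≤1+k) (covers-∷ˢ covers) paired′
      where
      paired′ : Paired D (v ∷ S)
      paired′ _ (here refl) = pv∈D
      paired′ u (there u∈S) = paired u u∈S
    ... | no pv∉D = move (partner v) (pv∉D , pv∉v∷S) (stallerToMove k (without v F)
                       (without-≤ (covers v free) F≤1+k) (covers-∷ᴰ (covers-∷ˢ covers)) paired′)
      where
      pv∉v∷S : partner v ∉ v ∷ S
      pv∉v∷S (here pv≡v) = partner-≢ v pv≡v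
      pv∉v∷S (there pv∈S) = v∉D (subst (_∈ D) (partner-involutive v) (paired (partner v) pv∈S))
      paired′ : Paired (partner v ∷ D) (v ∷ S)
      paired′ _ (here refl) = here refl
      paired′ u (there u∈S) = there (paired u u∈S)

    dominatorToMove : ∀ {D S} k F → length F ≤ k → Covers D S F → Paired D S → DomWinsD D S
    dominatorToMove {D} {S} k F F≤k covers paired with any? (free? D S) vertices
    ... | no none = won (paired-totDom paired (no-free-vertex none))
    ... | yes some with satisfied some
    ...   | w , free-w =
      move w free-w (stallerToMove k F F≤k (covers-∷ᴰ covers) (λ u → there ∘ paired u))

  dominator-wins : IsD
  dominator-wins = dominatorToMove n vertices ≤-refl (λ v _ → ∈-vertices v) (λ _ ())
                 , stallerToMove n vertices ≤-refl (λ v _ → ∈-vertices v) (λ _ ())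
    where n = length vertices

module LadderGame {V : Set} (Adj : V → V → Set) where
  open MBTD Adj

  -- Staller claims s 0, …, s r in turn.  Claiming s k leaves f k as the only free neighbour
  -- of x k, and claiming s r does so for x r and x (suc r) at once.
  record Ladder : Set where
    field
      r : ℕ
      x s f : ℕ → V
      nbhd : ∀ {k} → k ≤ suc r → ∀ y → Adj (x k) y → y ≡ f k ⊎ ∃ λ j → j ≤ k × j ≤ r × y ≡ s j
      s-injective : ∀ {j k} → j ≤ r → k ≤ r → s j ≡ s k → j ≡ k
      f-injective : ∀ {j k} → j ≤ suc r → k ≤ suc r → f j ≡ f k → j ≡ k
      s≢f : ∀ {j k} → j ≤ r → k ≤ suc r → s j ≢ f k

  module _ (L : Ladder) where
    open Ladder L

    OnLadderFrom : ℕ → V → Set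
    OnLadderFrom k v = (∃ λ j → k ≤ j × j ≤ r × v ≡ s j) ⊎ (∃ λ j → k ≤ j × j ≤ suc r × v ≡ f j)

    OnLadder : V → Set
    OnLadder = OnLadderFrom 0

    onLadderFrom-suc : ∀ {k v} → OnLadderFrom (suc k) v → OnLadderFrom k v
    onLadderFrom-suc (inj₁ (j , k<j , j≤r , v≡s)) = inj₁ (j , ≤-trans (n≤1+n _) k<j , j≤r , v≡s)
    onLadderFrom-suc (inj₂ (j , k<j , j≤r , v≡f)) = inj₂ (j , ≤-trans (n≤1+n _) k<j , j≤r , v≡f)

    onLadderFrom-suc-≢ : ∀ {k v} → k ≤ r → OnLadderFrom (suc k) v → v ≢ s k × v ≢ f k
    onLadderFrom-suc-≢ k≤r (inj₁ (j , k<j , j≤r , refl)) =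
      (λ e → <⇒≢ k<j (sym (s-injective j≤r k≤r e))) , s≢f j≤r (m≤n⇒m≤1+n k≤r)
    onLadderFrom-suc-≢ k≤r (inj₂ (j , k<j , j≤1+r , refl)) =
      (λ e → s≢f k≤r j≤1+r (sym e)) , (λ e → <⇒≢ k<j (sym (f-injective j≤1+r (m≤n⇒m≤1+n k≤r) e)))

    module _ (_≟_ : DecidableEquality V) where
      open StallerThreats Adj _≟_

      climb : ∀ d {k D S} → d + k ≡ r → (∀ {j} → j < k → s j ∈ S)
            → (∀ v → OnLadderFrom k v → Free D S v) → StaWinsS D S
      climb d {k} {D} {S} d+k≡r earlier free =
        threat (x k) (s k) (f k) (free (s k) s-on) free-f
               (threatened-by (m≤n⇒m≤1+n k≤r) (λ j≤k _ → j≤k)) (forced d d+k≡r)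
        where
        k≤r : k ≤ r
        k≤r = subst (k ≤_) d+k≡r (m≤n+m k d)
        s-on : OnLadderFrom k (s k)
        s-on = inj₁ (k , ≤-refl , k≤r , refl)
        free-f : Free D (s k ∷ S) (f k)
        free-f with free (f k) (inj₂ (k , ≤-refl , m≤n⇒m≤1+n k≤r , refl))
        ... | f∉D , f∉S = f∉D , ∉-∷ (λ e → s≢f k≤r (m≤n⇒m≤1+n k≤r) (sym e)) f∉S
        claimed : ∀ {j} → j ≤ k → s j ∈ s k ∷ S
        claimed j≤k with m≤n⇒m<n∨m≡n j≤k
        ... | inj₁ j<k = there (earlier j<k)
        ... | inj₂ refl = here refl
        threatened-by : ∀ {i} → i ≤ suc r → (∀ {j} → j ≤ i → j ≤ r → j ≤ k)
                      → ∀ y → Adj (x i) y → y ∈ s k ∷ S ⊎ y ≡ f i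
        threatened-by i≤1+r below-k y x~y with nbhd i≤1+r y x~y
        ... | inj₁ y≡f = inj₂ y≡f
        ... | inj₂ (j , j≤i , j≤r , refl) = inj₁ (claimed (below-k j≤i j≤r))
        free′ : ∀ v → OnLadderFrom (suc k) v → Free (f k ∷ D) (s k ∷ S) v
        free′ v on with free v (onLadderFrom-suc on) | onLadderFrom-suc-≢ k≤r on
        ... | v∉D , v∉S | v≢s , v≢f = ∉-∷ v≢f v∉D , ∉-∷ v≢s v∉S
        forced : ∀ d → d + k ≡ r → StaWinsS (f k ∷ D) (s k ∷ S)
        forced zero refl =
          claim-last (x (suc r)) (f (suc r)) (threatened-by ≤-refl (λ _ j≤r → j≤r))
                     (free′ (f (suc r)) (inj₂ (suc r , ≤-refl , ≤-refl , refl)))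
        forced (suc d) d+k≡r = climb d (trans (+-suc d k) d+k≡r) (claimed ∘ ≤-pred) free′

      ladder-wins : ∀ {D} → (∀ v → OnLadder v → v ∉ D) → StaWinsS D []
      ladder-wins off = climb r (+-identityʳ r) (λ ()) (λ v on → off v on , λ ())

-- `from` is a bijection carrying every edge of W to an edge of V, so W is a spanning subgraph
-- of V up to relabelling, and Staller, who only needs to claim a neighbourhood, is better off on W.
module SpanningSubgraph {V W : Set} (AdjV : V → V → Set) (AdjW : W → W → Set)
  (to : V → W) (from : W → V) (from∘to : ∀ v → from (to v) ≡ v) (to∘from : ∀ w → to (from w) ≡ w)
  (from-adj : ∀ {u w} → AdjW u w → AdjV (from u) (from w)) where
  module G = MBTD AdjV
  module H = MBTD AdjW

  to-injective : ∀ {u v} → to u ≡ to v → u ≡ v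
  to-injective {u} {v} tu≡tv = trans (sym (from∘to u)) (trans (cong from tu≡tv) (from∘to v))

  ∉-map-to : ∀ {v L} → v ∉ L → to v ∉ map to L
  ∉-map-to {v} {L} v∉L tv∈ with ∈-map⁻ to tv∈
  ... | u , u∈L , tv≡tu = v∉L (subst (_∈ L) (sym (to-injective tv≡tu)) u∈L)

  free-to : ∀ {D S v} → G.Free D S v → H.Free (map to D) (map to S) (to v)
  free-to (v∉D , v∉S) = ∉-map-to v∉D , ∉-map-to v∉S

  ∈-map-to : ∀ {w L} → from w ∈ L → w ∈ map to L
  ∈-map-to {w} = subst (_∈ _) (to∘from w) ∘ ∈-map⁺ to

  free-from : ∀ {D S w} → H.Free (map to D) (map to S) w → G.Free D S (from w)
  free-from (w∉D , w∉S) = w∉D ∘ ∈-map-to , w∉S ∘ ∈-map-to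

  claims-to : ∀ {S} → G.StallerClaimsNbhd S → H.StallerClaimsNbhd (map to S)
  claims-to (x , nbhd⊆S) = to x , λ y x~y →
    ∈-map-to (nbhd⊆S (from y) (subst (λ z → AdjV z (from y)) (from∘to x) (from-adj x~y)))

  mutual
    staWinsS-to : ∀ {D S} → G.StaWinsS D S → H.StaWinsS (map to D) (map to S)
    staWinsS-to (G.won claims) = H.won (claims-to claims)
    staWinsS-to (G.move v free next) = H.move (to v) (free-to free) (staWinsD-to next)

    staWinsD-to : ∀ {D S} → G.StaWinsD D S → H.StaWinsD (map to D) (map to S)
    staWinsD-to (G.won claims) = H.won (claims-to claims)
    staWinsD-to {D} {S} (G.reply (v , free) next) = H.reply (to v , free-to free) λ w free-w →
      subst (λ u → H.StaWinsS (u ∷ map to D) (map to S)) (to∘from w)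
            (staWinsS-to (next (from w) (free-from free-w)))

  isS-to : G.IsS → H.IsS
  isS-to (winsD , winsS) = staWinsD-to winsD , staWinsS-to winsS

  answer-to : ∀ w → G.StaWinsS [ from w ] [] → H.StaWinsS [ w ] []
  answer-to w = subst (λ u → H.StaWinsS [ u ] []) (to∘from w) ∘ staWinsS-to

opposite-+ : ∀ {K} (j : Fin (suc K)) → toℕ (opposite j) + toℕ j ≡ K
opposite-+ j = trans (cong (_+ toℕ j) (opposite-prop j)) (m∸n+n≡m (toℕ≤pred[n] j))

opposite-step : ∀ {K} {j l : Fin (suc K)}
              → suc (toℕ j) ≡ toℕ l → suc (toℕ (opposite l)) ≡ toℕ (opposite j)
opposite-step {K} {j} {l} j+1≡l = +-cancelʳ-≡ (toℕ j) _ _ (begin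
  suc (toℕ (opposite l)) + toℕ j   ≡⟨ sym (+-suc _ (toℕ j)) ⟩
  toℕ (opposite l) + suc (toℕ j)   ≡⟨ cong (toℕ (opposite l) +_) j+1≡l ⟩
  toℕ (opposite l) + toℕ l         ≡⟨ opposite-+ l ⟩
  K                                ≡⟨ sym (opposite-+ j) ⟩
  toℕ (opposite j) + toℕ j         ∎)
  where open ≡-Reasoning

pathAdj-opposite : ∀ {K} {j l : Fin (suc K)} → PathAdj j l → PathAdj (opposite j) (opposite l)
pathAdj-opposite (inj₁ j+1≡l) = inj₂ (opposite-step j+1≡l)
pathAdj-opposite (inj₂ l+1≡j) = inj₁ (opposite-step l+1≡j)

reflect : ∀ {m K} → Fin m × Fin (suc K) → Fin m × Fin (suc K)
reflect (i , j) = i , opposite j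

reflect-involutive : ∀ {m K} (v : Fin m × Fin (suc K)) → reflect (reflect v) ≡ v
reflect-involutive (i , j) = cong (i ,_) (opposite-involutive j)

gridAdj-reflect : ∀ {m K} {u v : Fin m × Fin (suc K)}
                → GridAdj m (suc K) u v → GridAdj m (suc K) (reflect u) (reflect v)
gridAdj-reflect (inj₁ (refl , j~l)) = inj₁ (refl , pathAdj-opposite j~l)
gridAdj-reflect (inj₂ (i~k , refl)) = inj₂ (i~k , refl)

gridAdj-swap : ∀ {m n} {u v : Fin m × Fin n} → GridAdj m n u v → GridAdj n m (swap u) (swap v)
gridAdj-swap (inj₁ (i≡k , j~l)) = inj₂ (j~l , i≡k)
gridAdj-swap (inj₂ (i~k , j≡l)) = inj₁ (j≡l , i~k)

module Reflect (m K : ℕ) = SpanningSubgraph (GridAdj m (suc K)) (GridAdj m (suc K))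
  reflect reflect reflect-involutive reflect-involutive gridAdj-reflect

module Transpose (m n : ℕ) = SpanningSubgraph (GridAdj m n) (GridAdj n m)
  swap swap (λ _ → refl) (λ _ → refl) gridAdj-swap

decEq-grid : ∀ {m n} → DecidableEquality (Fin m × Fin n)
decEq-grid = ≡-dec _≟ᶠ_ _≟ᶠ_

grid-vertices : ∀ m n → List (Fin m × Fin n)
grid-vertices m n = cartesianProduct (allFin m) (allFin n)

∈-grid-vertices : ∀ {m n} (v : Fin m × Fin n) → v ∈ grid-vertices m n
∈-grid-vertices (i , j) = ∈-cartesianProduct⁺ (∈-allFin i) (∈-allFin j)

module PathPairing (p : ℕ) where
  partner : Fin (p * 2) → Fin (p * 2)
  partner = uncurry (λ i j → combine i (opposite j)) ∘ remQuot {p} 2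

  partner-combine : ∀ (i : Fin p) (j : Fin 2) → partner (combine i j) ≡ combine i (opposite j)
  partner-combine i j = cong (uncurry (λ i j → combine i (opposite j))) (remQuot-combine i j)

  partner-involutive : ∀ (x : Fin (p * 2)) → partner (partner x) ≡ x
  partner-involutive x with combine-surjective {p} {2} x
  ... | i , j , refl = begin
    partner (partner (combine i j))   ≡⟨ cong partner (partner-combine i j) ⟩
    partner (combine i (opposite j))  ≡⟨ partner-combine i (opposite j) ⟩
    combine i (opposite (opposite j)) ≡⟨ cong (combine i) (opposite-involutive j) ⟩
    combine i j                       ∎
    where open ≡-Reasoning

  partner-≢ : ∀ (x : Fin (p * 2)) → partner x ≢ x
  partner-≢ x px≡x with combine-surjective {p} {2} x
  ... | i , j , refl =
    opposite-≢ j (combine-injectiveʳ i (opposite j) i j (trans (sym (partner-combine i j)) px≡x))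
    where
    opposite-≢ : ∀ (j : Fin 2) → opposite j ≢ j
    opposite-≢ zero ()
    opposite-≢ (suc zero) ()

  pathAdj-combine : ∀ (i : Fin p) → PathAdj (combine {n = 2} i zero) (combine i (suc zero))
  pathAdj-combine i = inj₁ (begin
    suc (toℕ (combine i zero))   ≡⟨ cong suc (toℕ-combine i zero) ⟩
    suc (2 * toℕ i + 0)          ≡⟨ sym (+-suc _ 0) ⟩
    2 * toℕ i + 1                ≡⟨ sym (toℕ-combine i (suc zero)) ⟩
    toℕ (combine i (suc zero))   ∎)
    where open ≡-Reasoning

  pathAdj-partner : ∀ (x : Fin (p * 2)) → PathAdj x (partner x)
  pathAdj-partner x with combine-surjective {p} {2} x
  ... | i , zero , refl = subst (PathAdj _) (sym (partner-combine i zero)) (pathAdj-combine i)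
  ... | i , suc zero , refl =
    subst (PathAdj _) (sym (partner-combine i (suc zero))) (Sum.swap (pathAdj-combine i))

evenGrid-isD : ∀ p q → IsDGraph (p * 2) (q * 2)
evenGrid-isD p q = PairingStrategy.dominator-wins (GridAdj (p * 2) (q * 2)) decEq-grid
  (grid-vertices _ _) ∈-grid-vertices gridPartner
  (λ (i , j) → cong₂ _,_ (P.partner-involutive i) (Q.partner-involutive j))
  (λ (i , _) → P.partner-≢ i ∘ cong proj₁)
  (λ (i , j) → (i , Q.partner j) , inj₁ (refl , Q.pathAdj-partner j)
                                 , inj₂ (P.pathAdj-partner i , sym (Q.partner-involutive j)))
  where
  module P = PathPairing p
  module Q = PathPairing q
  gridPartner : Fin (p * 2) × Fin (q * 2) → Fin (p * 2) × Fin (q * 2)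
  gridPartner (i , j) = P.partner i , Q.partner j

clamp : ∀ {n} → ℕ → Fin (suc n)
clamp zero = zero
clamp {zero} (suc a) = zero
clamp {suc n} (suc a) = suc (clamp a)

toℕ-clamp : ∀ {n a} → a ≤ n → toℕ (clamp {n} a) ≡ a
toℕ-clamp {a = zero} _ = refl
toℕ-clamp {suc n} {suc a} (s≤s a≤n) = cong suc (toℕ-clamp a≤n)

clamp-toℕ : ∀ {n} {i : Fin (suc n)} {a} → toℕ i ≡ a → i ≡ clamp a
clamp-toℕ {i = zero} refl = refl
clamp-toℕ {suc n} {suc i} refl = cong suc (clamp-toℕ refl)

parity-2* : ∀ k → parity (2 * k) ≡ 0ℙ
parity-2* zero = refl
parity-2* (suc k) = subst (λ n → parity n ≡ 0ℙ) (sym (*-suc 2 k)) (parity-2* k)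

parity-1+2* : ∀ k → parity (suc (2 * k)) ≡ 1ℙ
parity-1+2* zero = refl
parity-1+2* (suc k) = subst (λ n → parity (suc n) ≡ 1ℙ) (sym (*-suc 2 k)) (parity-1+2* k)

-- The odd-grid ladder uses the cells (2k+1 , 0) and (2k , 1): this row in a column of this parity.
ladderRow : Parity → ℕ
ladderRow 0ℙ = 1
ladderRow 1ℙ = 0

row0-neighbour : ∀ {m n} {i k : Fin m} {j l : Fin n} → toℕ j ≡ 0 → GridAdj m n (i , j) (k , l)
               → (k ≡ i × toℕ l ≡ 1) ⊎ (PathAdj i k × l ≡ j)
row0-neighbour j≡0 (inj₁ (refl , inj₁ j+1≡l)) = inj₁ (refl , trans (sym j+1≡l) (cong suc j≡0))
row0-neighbour j≡0 (inj₁ (refl , inj₂ l+1≡j)) = ⊥-elim (0≢1+n (trans (sym j≡0) (sym l+1≡j)))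
row0-neighbour j≡0 (inj₂ (i~k , refl)) = inj₂ (i~k , refl)

module OddGrid (r N : ℕ) where
  M : ℕ
  M = 2 * suc r

  Vertex : Set
  Vertex = Fin (suc M) × Fin (suc (suc N))

  Adj : Vertex → Vertex → Set
  Adj = GridAdj (suc M) (suc (suc N))

  open MBTD Adj
  open LadderGame Adj

  ⟨_,_⟩ : ℕ → ℕ → Vertex
  ⟨ a , b ⟩ = clamp a , clamp b

  even-bound : ∀ {k} → k ≤ suc r → 2 * k ≤ M
  even-bound = *-monoʳ-≤ 2

  odd-bound : ∀ {k} → k ≤ r → suc (2 * k) ≤ M
  odd-bound {k} k≤r = subst (suc (2 * k) ≤_) (sym (*-suc 2 r)) (m≤n⇒m≤1+n (s≤s (*-monoʳ-≤ 2 k≤r)))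

  column-≡ : ∀ {a c} {j l : Fin (suc (suc N))} → (clamp a , j) ≡ (clamp c , l)
           → a ≤ M → c ≤ M → a ≡ c
  column-≡ e a≤M c≤M = trans (sym (toℕ-clamp a≤M)) (trans (cong (toℕ ∘ proj₁) e) (toℕ-clamp c≤M))

  column-neighbour : ∀ {k} {i : Fin (suc M)} → k ≤ suc r → PathAdj (clamp {M} (2 * k)) i
                   → ∃ λ j → j ≤ k × j ≤ r × i ≡ clamp (suc (2 * j))
  column-neighbour {k} {i} k≤1+r (inj₁ e) with m≤n⇒m<n∨m≡n k≤1+r
  ... | inj₁ k<1+r =
    k , ≤-refl , ≤-pred k<1+r , clamp-toℕ (trans (sym e) (cong suc (toℕ-clamp (even-bound k≤1+r))))
  ... | inj₂ refl = ⊥-elim (<⇒≢ (toℕ<n i) (trans (sym e) (cong suc (toℕ-clamp ≤-refl))))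
  column-neighbour {zero} _ (inj₂ ())
  column-neighbour {suc k} k<1+r (inj₂ e) =
    k , n≤1+n k , ≤-pred k<1+r ,
    clamp-toℕ (suc-injective (trans e (trans (toℕ-clamp (even-bound k<1+r)) (*-suc 2 k))))

  ladder : Ladder
  ladder = record
    { r = r
    ; x = λ k → ⟨ 2 * k , 0 ⟩
    ; s = λ k → ⟨ suc (2 * k) , 0 ⟩
    ; f = λ k → ⟨ 2 * k , 1 ⟩
    ; nbhd = nbhd
    ; s-injective = λ j≤r k≤r e →
        *-cancelˡ-≡ _ _ 2 (suc-injective (column-≡ e (odd-bound j≤r) (odd-bound k≤r)))
    ; f-injective = λ j≤ k≤ e → *-cancelˡ-≡ _ _ 2 (column-≡ e (even-bound j≤) (even-bound k≤))
    ; s≢f = λ _ _ e → 0≢1+n (cong (toℕ ∘ proj₂) e)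
    }
    where
    nbhd : ∀ {k} → k ≤ suc r → ∀ y → Adj ⟨ 2 * k , 0 ⟩ y
         → y ≡ ⟨ 2 * k , 1 ⟩ ⊎ ∃ λ j → j ≤ k × j ≤ r × y ≡ ⟨ suc (2 * j) , 0 ⟩
    nbhd k≤1+r (i , j) x~y with row0-neighbour refl x~y
    ... | inj₁ (refl , j≡1) = inj₁ (cong (_ ,_) (clamp-toℕ j≡1))
    ... | inj₂ (i~k , refl) with column-neighbour k≤1+r i~k
    ...   | j , j≤k , j≤r , refl = inj₂ (j , j≤k , j≤r , refl)

  onLadder-row : ∀ {i j} → OnLadder ladder (i , j) → toℕ j ≡ ladderRow (parity (toℕ i))
  onLadder-row (inj₁ (k , _ , k≤r , refl)) rewrite toℕ-clamp (odd-bound k≤r) | parity-1+2* k = refl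
  onLadder-row (inj₂ (k , _ , k≤1+r , refl)) rewrite toℕ-clamp (even-bound k≤1+r) | parity-2* k = refl

  avoid : ∀ {i j} → toℕ j ≢ ladderRow (parity (toℕ i)) → StaWinsS [ (i , j) ] []
  avoid off = ladder-wins ladder decEq-grid λ { _ on (here refl) → off (onLadder-row on) }

  opening : StaWinsS [] []
  opening = ladder-wins ladder decEq-grid λ _ _ ()

reflection-fixes-row : ∀ {N} (j : Fin (suc (suc N))) p
                     → toℕ j ≡ ladderRow p → toℕ (opposite j) ≡ ladderRow p → N ≡ 1 × p ≡ 0ℙ
reflection-fixes-row j 0ℙ j≡1 j′≡1 = suc-injective (trans (sym (opposite-+ j)) (cong₂ _+_ j′≡1 j≡1)) , refl
reflection-fixes-row j 1ℙ j≡0 j′≡0 with trans (sym (opposite-+ j)) (cong₂ _+_ j′≡0 j≡0)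
... | ()

opposite-≢0 : ∀ {K} (j : Fin (suc (suc K))) → toℕ j ≡ 0 → toℕ (opposite j) ≢ 0
opposite-≢0 j j≡0 j′≡0 with trans (sym (opposite-+ j)) (cong₂ _+_ j′≡0 j≡0)
... | ()

-- P_3 □ P_(2r+3) is OddGrid 0 (pred (2 * suc r)) because 2 * suc r reduces to a successor.
middleRow-answer : ∀ r (i : Fin (suc (2 * suc r))) (j : Fin 3) → toℕ j ≡ 1
                 → MBTD.StaWinsS (OddGrid.Adj r 1) [ (i , j) ] []
middleRow-answer r i j j≡1 with toℕ i ≟ⁿ 0
... | no i≢0 = Transpose.answer-to _ _ (i , j) (OddGrid.avoid 0 (pred (2 * suc r)) off)
  where
  off : toℕ i ≢ ladderRow (parity (toℕ j))
  off rewrite j≡1 = i≢0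
... | yes i≡0 =
  Transpose.answer-to _ _ (i , j) (Reflect.answer-to _ _ (j , i) (OddGrid.avoid 0 (pred (2 * suc r)) off))
  where
  off : toℕ (opposite i) ≢ ladderRow (parity (toℕ j))
  off rewrite j≡1 = opposite-≢0 i i≡0

oddGrid-answer : ∀ r N v → MBTD.StaWinsS (OddGrid.Adj r N) [ v ] []
oddGrid-answer r N (i , j) with toℕ j ≟ⁿ ladderRow (parity (toℕ i))
... | no off = OddGrid.avoid r N off
... | yes on with toℕ (opposite j) ≟ⁿ ladderRow (parity (toℕ i))
...   | no off = Reflect.answer-to _ _ (i , j) (OddGrid.avoid r N off)
...   | yes on′ with reflection-fixes-row j _ on on′
...     | refl , even = middleRow-answer r i j (trans on (cong ladderRow even))

oddGrid-isS : ∀ r N → IsSGraph (suc (2 * suc r)) (suc (suc N))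
oddGrid-isS r N = isS-from-answers (OddGrid.Adj r N) (zero , zero)
  (oddGrid-answer r N) (OddGrid.opening r N)

odd-form : ∀ {m} → ¬ 2 ∣ m → ∃ λ q → m ≡ suc (2 * q)
odd-form {zero} 2∤0 = ⊥-elim (2∤0 (divides-refl 0))
odd-form {suc zero} _ = 0 , refl
odd-form {suc (suc m)} 2∤m+2
  with odd-form {m} (2∤m+2 ∘ λ { (divides q m≡q*2) → divides (suc q) (cong (2 +_) m≡q*2) })
... | q , refl = suc q , cong suc (sym (*-suc 2 q))

grid-isD : ∀ {m n} → 2 ∣ m × 2 ∣ n → IsDGraph m n
grid-isD (divides-refl p , divides-refl q) = evenGrid-isD p q

grid-isS : ∀ {m n} → 2 ≤ m → 2 ≤ n → ¬ (2 ∣ m × 2 ∣ n) → IsSGraph m n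
grid-isS {m} 2≤m 2≤n not-both with 2 ∣? m
... | no 2∤m with odd-form 2∤m | 2≤m | 2≤n
...   | suc r , refl | _ | s≤s (s≤s _) = oddGrid-isS r _
...   | zero , refl | s≤s () | _
grid-isS {m} 2≤m 2≤n not-both | yes 2∣m with odd-form (λ 2∣n → not-both (2∣m , 2∣n)) | 2≤n | 2≤m
...   | suc r , refl | _ | s≤s (s≤s _) = Transpose.isS-to _ _ (oddGrid-isS r _)
...   | zero , refl | s≤s () | _

theorem4p2 : (m n : ℕ) → 2 ≤ m → 2 ≤ n →
    ((2 ∣ m × 2 ∣ n) → IsDGraph m n) × (¬ (2 ∣ m × 2 ∣ n) → IsSGraph m n)
theorem4p2 m n 2≤m 2≤n = grid-isD , grid-isS 2≤m 2≤n
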